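{- Let $\mathcal D$ be a regular dessin whose automorphism group $G$ acts primitively on its set $V$ of black vertices, and let $K$ be the kernel of this action. Then $K$ is a cyclic normal subgroup of $G$, and either (a) the permutation group $G/K$ induced by $G$ on $V$ is regular of prime degree, or (b) $G/K$ is a Frobenius group on $V$, and $K$ is contained in the centre of $G$.
   Context: A regular dessin is determined up to isomorphism by a triple $(G;x,y)$ with $G$ a finite group generated by $x,y$; its black vertices are the left cosets of $\langle x\rangle$ in $G$, and its automorphism group $G$ acts on them by left multiplication (so vertex stabilisers are conjugates of the cyclic group $\langle x\rangle$). A Frobenius group is a transitive permutation group which is not regular and in which only the identity fixes two distinct points. -}

module Defs where

open import Level using (Level; _⊔_)
open import Algebra.Bundles using (Group)
open import Data.Nat using (ℕ; zero; suc)
open import Data.Nat.Primality using (Prime)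
open import Data.Integer using (ℤ; +_; -[1+_])
open import Data.Fin using (Fin)
open import Data.Product using (Σ; ∃; _×_)
open import Data.Sum using (_⊎_)
open import Relation.Nullary using (¬_)
open import Relation.Binary.Core using (Rel)
open import Relation.Binary.Definitions using (Decidable)
open import Relation.Binary.Structures using (IsEquivalence)
open import Relation.Binary.PropositionalEquality using (_≡_)

module _ {c ℓ : Level} (G : Group c ℓ) where
  open Group G

  pow : Carrier → ℕ → Carrier
  pow g zero    = ε
  pow g (suc n) = g ∙ pow g n

  zpow : Carrier → ℤ → Carrier
  zpow g (+ n)      = pow g n
  zpow g -[1+ n ]   = (pow g (suc n)) ⁻¹

  IsFinite : Set (c ⊔ ℓ)
  IsFinite = Decidable _≈_ ×
    Σ ℕ (λ n → Σ (Fin n → Carrier) (λ e → ∀ g → ∃ (λ i → g ≈ e i)))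

  data Gen (x y : Carrier) : Carrier → Set (c ⊔ ℓ) where
    gen-x   : Gen x y x
    gen-y   : Gen x y y
    gen-ε   : Gen x y ε
    gen-∙   : ∀ {a b} → Gen x y a → Gen x y b → Gen x y (a ∙ b)
    gen-⁻¹  : ∀ {a} → Gen x y a → Gen x y (a ⁻¹)
    gen-≈   : ∀ {a b} → a ≈ b → Gen x y a → Gen x y b

  Generates : Carrier → Carrier → Set (c ⊔ ℓ)
  Generates x y = ∀ g → Gen x y g

  InCyc : Carrier → Carrier → Set ℓ
  InCyc x g = ∃ λ (z : ℤ) → g ≈ zpow x z

  -- black vertices = left cosets g⟨x⟩, represented by elements g;
  -- two representatives give the same vertex iff g⁻¹h ∈ ⟨x⟩.
  SameVertex : Carrier → Carrier → Carrier → Set ℓ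
  SameVertex x g h = InCyc x (g ⁻¹ ∙ h)

  Fixes : Carrier → Carrier → Carrier → Set ℓ
  Fixes x a v = SameVertex x (a ∙ v) v

  InKernel : Carrier → Carrier → Set (c ⊔ ℓ)
  InKernel x a = ∀ v → Fixes x a v

  IsPrimitiveOnVertices : Carrier → Set (Level.suc (c ⊔ ℓ))
  IsPrimitiveOnVertices x =
    (∃ λ g → ¬ SameVertex x ε g) ×
    (∀ (R : Rel Carrier (c ⊔ ℓ)) → IsEquivalence R →
       (∀ g h → SameVertex x g h → R g h) →
       (∀ a g h → R g h → R (a ∙ g) (a ∙ h)) →
       (∀ g h → R g h → SameVertex x g h) ⊎ (∀ g h → R g h))

  IsNormalSubgroup : ∀ {p} → (Carrier → Set p) → Set (c ⊔ ℓ ⊔ p)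
  IsNormalSubgroup P =
    (∀ {a b} → a ≈ b → P a → P b) ×
    P ε ×
    (∀ {a b} → P a → P b → P (a ∙ b)) ×
    (∀ {a} → P a → P (a ⁻¹)) ×
    (∀ g {a} → P a → P (g ∙ a ∙ g ⁻¹))

  IsCyclic : ∀ {p} → (Carrier → Set p) → Set (c ⊔ ℓ ⊔ p)
  IsCyclic P = ∃ λ t → P t × (∀ a → P a → InCyc t a)

  NumVertices : Carrier → ℕ → Set (c ⊔ ℓ)
  NumVertices x n = Σ (Fin n → Carrier) λ e →
    (∀ i j → SameVertex x (e i) (e j) → i ≡ j) ×
    (∀ g → ∃ λ i → SameVertex x g (e i))

  TransitiveOnVertices : Carrier → Set (c ⊔ ℓ)
  TransitiveOnVertices x = ∀ v w → ∃ λ a → SameVertex x (a ∙ v) w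

  -- G/K acts regularly on V: transitive, and only the identity of G/K
  -- (i.e. elements of K) fixes a point
  RegularOnVertices : Carrier → Set (c ⊔ ℓ)
  RegularOnVertices x = TransitiveOnVertices x ×
    (∀ a v → Fixes x a v → InKernel x a)

  FrobeniusOnVertices : Carrier → Set (c ⊔ ℓ)
  FrobeniusOnVertices x = TransitiveOnVertices x ×
    (∃ λ a → ∃ λ v → Fixes x a v × ¬ InKernel x a) ×
    (∀ a v w → ¬ SameVertex x v w → Fixes x a v → Fixes x a w → InKernel x a)

  InCentre : ∀ {p} → (Carrier → Set p) → Set (c ⊔ ℓ ⊔ p)
  InCentre P = ∀ a → P a → ∀ g → a ∙ g ≈ g ∙ a

{-# OPTIONS --safe #-}
-- Write H = ⟨x⟩, so that the black vertices are the cosets g H and the kernel K is the core of H.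
-- As a subgroup of the cyclic group H, K is cyclic. Primitivity says exactly that H is a maximal
-- subgroup, and in a finite group a subset closed under products is already a subgroup.
-- If x ∈ K, then H = K is normal and G/H acts regularly; for g ∉ H the subgroup ⟨g⟩H is G, so the
-- vertices are g^i H for i below the order p of g modulo H. A divisor 1 < d < p of p is
-- impossible: ⟨g^d⟩H = G contains g, so p ∣ j d - 1 for some j, and then d ∣ 1.
-- If x ∉ K, then H is self-normalising, and an element fixing two vertices is conjugate into
-- H ∩ gHg⁻¹ with g ∉ H; the centraliser of this intersection contains the distinct abelian groups
-- H and gHg⁻¹, hence is G, so the element is central and lies in K. Likewise the centraliser of the
-- normal subgroup K contains H and every conjugate of x, hence is G.
module Submission where

open import Defs
open import Level using (Level; _⊔_; Lift; lift; lower)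
open import Algebra.Bundles using (Group)
open import Data.Nat using (ℕ; zero; suc; _+_; _*_; _<_; _≤_; _%_; _/_; z≤n; s≤s; NonZero; n>1⇒nonTrivial; nonTrivial⇒n>1)
open import Data.Nat.Properties using (+-comm; +-suc; +-identityʳ; m≤n⇒∃[o]m+o≡n; ≤-total; ≤-<-trans; m≤n+m; ≤∧≢⇒<; <-irrefl; n<1+n)
open import Data.Nat.DivMod using (m≡m%n+[m/n]*n; m%n<n)
open import Data.Nat.Divisibility using (_∣_; divides; m%n≡0⇒n∣m; ∣m+n∣m⇒∣n; ∣1⇒≡1; ∣-trans)
open import Data.Nat.Primality using (Prime; prime; composite)
open import Data.Fin using (Fin; toℕ; fromℕ; fromℕ<)
open import Data.Fin.Properties using (pigeonhole; any?; all?; ¬∀⟶∃¬-smallest; toℕ-fromℕ; toℕ-fromℕ<; toℕ-inject; toℕ-injective; toℕ<n)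
open import Data.Integer using (+_; -[1+_])
open import Data.Product using (∃; _×_; _,_; proj₁; proj₂)
open import Data.Sum as Sum using (_⊎_; inj₁; inj₂)
open import Relation.Nullary using (¬_; Dec; yes; no; contradiction)
open import Relation.Nullary.Decidable using (¬?; decidable-stable; map′; toSum)
open import Relation.Unary using (Pred; Decidable; _∈_; _∉_; _⊆_; _∩_)
open import Relation.Binary.Structures using (IsEquivalence)
open import Relation.Binary.PropositionalEquality as ≡ using (_≡_)

least-positive : ∀ {p} {Q : Pred ℕ p} → Decidable Q → ∀ n → Q (suc n) →
                 ∃ λ m → Q (suc m) × (∀ {j} → j < m → ¬ Q (suc j))
least-positive {Q = Q} Q? n Q[1+n]
  with ¬∀⟶∃¬-smallest (suc n) (λ i → ¬ Q (suc (toℕ i))) (λ i → ¬? (Q? _))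
         (λ never → never (fromℕ n) (≡.subst (λ k → Q (suc k)) (≡.sym (toℕ-fromℕ n)) Q[1+n]))
... | i , ¬¬Q[1+i] , below = toℕ i , decidable-stable (Q? _) ¬¬Q[1+i] , λ {j} j<i Q[1+j] →
  below (fromℕ< j<i)
        (≡.subst (λ k → Q (suc k)) (≡.sym (≡.trans (toℕ-inject (fromℕ< j<i)) (toℕ-fromℕ< j<i))) Q[1+j])

module GroupTheory {c ℓ : Level} (G : Group c ℓ) where
  open Group G
  open import Algebra.Properties.Group G public
  open import Relation.Binary.Reasoning.Setoid setoid

  infixl 9 _^_
  _^_ : Carrier → ℕ → Carrier
  a ^ n = pow G a n

  ^-cong : ∀ {a b} n → a ≈ b → a ^ n ≈ b ^ n
  ^-cong zero    a≈b = refl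
  ^-cong (suc n) a≈b = ∙-cong a≈b (^-cong n a≈b)

  ^-distribˡ-+-∙ : ∀ a m n → a ^ (m + n) ≈ a ^ m ∙ a ^ n
  ^-distribˡ-+-∙ a zero    n = sym (identityˡ _)
  ^-distribˡ-+-∙ a (suc m) n = trans (∙-congˡ (^-distribˡ-+-∙ a m n)) (sym (assoc _ _ _))

  ^-*-assoc : ∀ a m n → (a ^ m) ^ n ≈ a ^ (n * m)
  ^-*-assoc a m zero    = refl
  ^-*-assoc a m (suc n) = trans (∙-congˡ (^-*-assoc a m n)) (sym (^-distribˡ-+-∙ a m (n * m)))

  ε^≈ε : ∀ n → ε ^ n ≈ ε
  ε^≈ε zero    = refl
  ε^≈ε (suc n) = trans (identityˡ _) (ε^≈ε n)

  ^-comm : ∀ a m n → a ^ m ∙ a ^ n ≈ a ^ n ∙ a ^ m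
  ^-comm a m n = begin
    a ^ m ∙ a ^ n ≈⟨ ^-distribˡ-+-∙ a m n ⟨
    a ^ (m + n)   ≡⟨ ≡.cong (a ^_) (+-comm m n) ⟩
    a ^ (n + m)   ≈⟨ ^-distribˡ-+-∙ a n m ⟩
    a ^ n ∙ a ^ m ∎

  ^-divMod : ∀ a m .{{_ : NonZero m}} k → a ^ k ≈ a ^ (k % m) ∙ (a ^ m) ^ (k / m)
  ^-divMod a m k = begin
    a ^ k                         ≡⟨ ≡.cong (a ^_) (m≡m%n+[m/n]*n k m) ⟩
    a ^ (k % m + k / m * m)       ≈⟨ ^-distribˡ-+-∙ a (k % m) (k / m * m) ⟩
    a ^ (k % m) ∙ a ^ (k / m * m) ≈⟨ ∙-congˡ (^-*-assoc a m (k / m)) ⟨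
    a ^ (k % m) ∙ (a ^ m) ^ (k / m) ∎

  ^-mod-period : ∀ {a} r → a ^ suc r ≈ ε → ∀ k → a ^ k ≈ a ^ (k % suc r)
  ^-mod-period {a} r a^[1+r]≈ε k = begin
    a ^ k                                   ≈⟨ ^-divMod a (suc r) k ⟩
    a ^ (k % suc r) ∙ (a ^ suc r) ^ (k / suc r) ≈⟨ ∙-congˡ (^-cong (k / suc r) a^[1+r]≈ε) ⟩
    a ^ (k % suc r) ∙ ε ^ (k / suc r)       ≈⟨ ∙-congˡ (ε^≈ε (k / suc r)) ⟩
    a ^ (k % suc r) ∙ ε                     ≈⟨ identityʳ _ ⟩
    a ^ (k % suc r)                         ∎

  conj : Carrier → Carrier → Carrier
  conj u a = u ⁻¹ ∙ a ∙ u

  conj-cong : ∀ {u u′ a a′} → u ≈ u′ → a ≈ a′ → conj u a ≈ conj u′ a′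
  conj-cong u≈u′ a≈a′ = ∙-cong (∙-cong (⁻¹-cong u≈u′) a≈a′) u≈u′

  conj-ε : ∀ a → conj ε a ≈ a
  conj-ε a = trans (∙-congʳ (trans (∙-congʳ ε⁻¹≈ε) (identityˡ a))) (identityʳ a)

  conj-∙ : ∀ u w a → conj (u ∙ w) a ≈ conj w (conj u a)
  conj-∙ u w a = begin
    (u ∙ w) ⁻¹ ∙ a ∙ (u ∙ w)       ≈⟨ ∙-congʳ (∙-congʳ (⁻¹-anti-homo-∙ u w)) ⟩
    w ⁻¹ ∙ u ⁻¹ ∙ a ∙ (u ∙ w)      ≈⟨ assoc _ u w ⟨
    w ⁻¹ ∙ u ⁻¹ ∙ a ∙ u ∙ w        ≈⟨ ∙-congʳ (∙-congʳ (assoc _ _ _)) ⟩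
    w ⁻¹ ∙ (u ⁻¹ ∙ a) ∙ u ∙ w      ≈⟨ ∙-congʳ (assoc _ _ _) ⟩
    w ⁻¹ ∙ (u ⁻¹ ∙ a ∙ u) ∙ w      ∎

  conj-⁻¹-conj : ∀ u a → conj (u ⁻¹) (conj u a) ≈ a
  conj-⁻¹-conj u a = trans (sym (conj-∙ u (u ⁻¹) a)) (trans (conj-cong (inverseʳ u) refl) (conj-ε a))

  conj-conj-⁻¹ : ∀ u a → conj u (conj (u ⁻¹) a) ≈ a
  conj-conj-⁻¹ u a = trans (sym (conj-∙ (u ⁻¹) u a)) (trans (conj-cong (inverseˡ u) refl) (conj-ε a))

  conj-homo-∙ : ∀ u a b → conj u (a ∙ b) ≈ conj u a ∙ conj u b
  conj-homo-∙ u a b = begin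
    u ⁻¹ ∙ (a ∙ b) ∙ u              ≈⟨ ∙-congʳ (assoc _ a b) ⟨
    u ⁻¹ ∙ a ∙ b ∙ u                ≈⟨ assoc _ b u ⟩
    u ⁻¹ ∙ a ∙ (b ∙ u)              ≈⟨ ∙-congˡ (∙-congʳ (\\-leftDividesˡ u b)) ⟨
    u ⁻¹ ∙ a ∙ (u ∙ (u ⁻¹ ∙ b) ∙ u) ≈⟨ ∙-congˡ (assoc u _ u) ⟩
    u ⁻¹ ∙ a ∙ (u ∙ (u ⁻¹ ∙ b ∙ u)) ≈⟨ assoc _ u _ ⟨
    u ⁻¹ ∙ a ∙ u ∙ (u ⁻¹ ∙ b ∙ u)   ∎

  conj-homo-ε : ∀ u → conj u ε ≈ ε
  conj-homo-ε u = trans (∙-congʳ (identityʳ _)) (inverseˡ u)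

  conj-homo-⁻¹ : ∀ u a → conj u (a ⁻¹) ≈ conj u a ⁻¹
  conj-homo-⁻¹ u a = inverseʳ-unique (conj u a) (conj u (a ⁻¹))
    (trans (sym (conj-homo-∙ u a (a ⁻¹))) (trans (conj-cong refl (inverseʳ a)) (conj-homo-ε u)))

  conj-homo-^ : ∀ u a n → conj u (a ^ n) ≈ conj u a ^ n
  conj-homo-^ u a zero    = conj-homo-ε u
  conj-homo-^ u a (suc n) = trans (conj-homo-∙ u a (a ^ n)) (∙-congˡ (conj-homo-^ u a n))

  comm⇒conj≈ : ∀ {u a} → a ∙ u ≈ u ∙ a → conj u a ≈ a
  comm⇒conj≈ {u} {a} au≈ua = begin
    u ⁻¹ ∙ a ∙ u   ≈⟨ assoc _ _ _ ⟩
    u ⁻¹ ∙ (a ∙ u) ≈⟨ ∙-congˡ au≈ua ⟩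
    u ⁻¹ ∙ (u ∙ a) ≈⟨ \\-leftDividesʳ u a ⟩
    a              ∎

  conj-preserves-comm : ∀ u {a b} → a ∙ b ≈ b ∙ a → conj u a ∙ conj u b ≈ conj u b ∙ conj u a
  conj-preserves-comm u {a} {b} ab≈ba = begin
    conj u a ∙ conj u b ≈⟨ conj-homo-∙ u a b ⟨
    conj u (a ∙ b)      ≈⟨ conj-cong refl ab≈ba ⟩
    conj u (b ∙ a)      ≈⟨ conj-homo-∙ u b a ⟩
    conj u b ∙ conj u a ∎

  conj-reflects-comm : ∀ u {a b} → conj u a ∙ conj u b ≈ conj u b ∙ conj u a → a ∙ b ≈ b ∙ a
  conj-reflects-comm u {a} {b} comm = begin
    a ∙ b                                           ≈⟨ ∙-cong (conj-⁻¹-conj u a) (conj-⁻¹-conj u b) ⟨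
    conj (u ⁻¹) (conj u a) ∙ conj (u ⁻¹) (conj u b) ≈⟨ conj-preserves-comm (u ⁻¹) comm ⟩
    conj (u ⁻¹) (conj u b) ∙ conj (u ⁻¹) (conj u a) ≈⟨ ∙-cong (conj-⁻¹-conj u b) (conj-⁻¹-conj u a) ⟩
    b ∙ a                                           ∎

  ε⁻¹∙ : ∀ a → ε ⁻¹ ∙ a ≈ a
  ε⁻¹∙ a = trans (∙-congʳ ε⁻¹≈ε) (identityˡ a)

  ⁻¹∙-translate : ∀ a g h → (a ∙ g) ⁻¹ ∙ (a ∙ h) ≈ g ⁻¹ ∙ h
  ⁻¹∙-translate a g h = begin
    (a ∙ g) ⁻¹ ∙ (a ∙ h)      ≈⟨ ∙-congʳ (⁻¹-anti-homo-∙ a g) ⟩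
    g ⁻¹ ∙ a ⁻¹ ∙ (a ∙ h)     ≈⟨ assoc _ _ _ ⟩
    g ⁻¹ ∙ (a ⁻¹ ∙ (a ∙ h))   ≈⟨ ∙-congˡ (\\-leftDividesʳ a h) ⟩
    g ⁻¹ ∙ h                  ∎

  ⁻¹∙-∙ : ∀ a b d d′ → (a ∙ d) ⁻¹ ∙ (b ∙ d′) ≈ conj d (a ⁻¹ ∙ b) ∙ (d ⁻¹ ∙ d′)
  ⁻¹∙-∙ a b d d′ = sym (begin
    d ⁻¹ ∙ (a ⁻¹ ∙ b) ∙ d ∙ (d ⁻¹ ∙ d′)   ≈⟨ assoc _ d _ ⟩
    d ⁻¹ ∙ (a ⁻¹ ∙ b) ∙ (d ∙ (d ⁻¹ ∙ d′)) ≈⟨ ∙-congˡ (\\-leftDividesˡ d d′) ⟩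
    d ⁻¹ ∙ (a ⁻¹ ∙ b) ∙ d′                ≈⟨ assoc _ _ _ ⟩
    d ⁻¹ ∙ (a ⁻¹ ∙ b ∙ d′)                ≈⟨ ∙-congˡ (assoc _ _ _) ⟩
    d ⁻¹ ∙ (a ⁻¹ ∙ (b ∙ d′))              ≈⟨ assoc _ _ _ ⟨
    d ⁻¹ ∙ a ⁻¹ ∙ (b ∙ d′)                ≈⟨ ∙-congʳ (⁻¹-anti-homo-∙ a d) ⟨
    (a ∙ d) ⁻¹ ∙ (b ∙ d′)                 ∎)

  record IsSubmonoid {p} (P : Pred Carrier p) : Set (c ⊔ ℓ ⊔ p) where
    field
      ∈-resp-≈ : ∀ {a b} → a ≈ b → P a → P b
      ε-∈      : P ε
      ∙-∈      : ∀ {a b} → P a → P b → P (a ∙ b)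

    ^-∈ : ∀ {a} n → P a → P (a ^ n)
    ^-∈ zero    a∈P = ε-∈
    ^-∈ (suc n) a∈P = ∙-∈ a∈P (^-∈ n a∈P)

  IsAbelian : ∀ {p} → Pred Carrier p → Set (c ⊔ ℓ ⊔ p)
  IsAbelian P = ∀ {a b} → P a → P b → a ∙ b ≈ b ∙ a

  Powers : Carrier → Pred Carrier ℓ
  Powers a b = ∃ λ k → b ≈ a ^ k

  powers-isSubmonoid : ∀ a → IsSubmonoid (Powers a)
  powers-isSubmonoid a = record
    { ∈-resp-≈ = λ { b≈b′ (k , b≈a^k) → k , trans (sym b≈b′) b≈a^k }
    ; ε-∈      = 0 , refl
    ; ∙-∈      = λ { (k , b≈a^k) (k′ , b′≈a^k′) →
                       k + k′ , trans (∙-cong b≈a^k b′≈a^k′) (sym (^-distribˡ-+-∙ a k k′)) }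
    }

  powers-abelian : ∀ a → IsAbelian (Powers a)
  powers-abelian a (k , b≈a^k) (k′ , b′≈a^k′) =
    trans (∙-cong b≈a^k b′≈a^k′) (trans (^-comm a k k′) (sym (∙-cong b′≈a^k′ b≈a^k)))

  Centraliser : ∀ {p} → Pred Carrier p → Pred Carrier (c ⊔ ℓ ⊔ p)
  Centraliser D u = ∀ d → D d → d ∙ u ≈ u ∙ d

  centraliser-isSubmonoid : ∀ {p} {D : Pred Carrier p} → IsSubmonoid (Centraliser D)
  centraliser-isSubmonoid = record
    { ∈-resp-≈ = λ u≈u′ u∈C d d∈D → trans (∙-congˡ (sym u≈u′)) (trans (u∈C d d∈D) (∙-congʳ u≈u′))
    ; ε-∈      = λ d _ → trans (identityʳ d) (sym (identityˡ d))
    ; ∙-∈      = λ {u} {w} u∈C w∈C d d∈D → begin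
        d ∙ (u ∙ w) ≈⟨ assoc _ _ _ ⟨
        d ∙ u ∙ w   ≈⟨ ∙-congʳ (u∈C d d∈D) ⟩
        u ∙ d ∙ w   ≈⟨ assoc _ _ _ ⟩
        u ∙ (d ∙ w) ≈⟨ ∙-congˡ (w∈C d d∈D) ⟩
        u ∙ (w ∙ d) ≈⟨ assoc _ _ _ ⟨
        u ∙ w ∙ d   ∎
    }

  abelian⊆centraliser : ∀ {p q} {P : Pred Carrier p} {D : Pred Carrier q} →
                        IsAbelian P → D ⊆ P → P ⊆ Centraliser D
  abelian⊆centraliser P-abelian D⊆P a∈P d d∈D = P-abelian (D⊆P d∈D) a∈P

  centraliser-conj : ∀ {p} {D : Pred Carrier p} → (∀ u {d} → D d → D (conj u d)) →
                     ∀ u {a} → Centraliser D a → Centraliser D (conj u a)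
  centraliser-conj D-conj u {a} a∈C d d∈D = begin
    d ∙ conj u a                          ≈⟨ ∙-congʳ (conj-conj-⁻¹ u d) ⟨
    conj u (conj (u ⁻¹) d) ∙ conj u a     ≈⟨ conj-preserves-comm u (a∈C _ (D-conj (u ⁻¹) d∈D)) ⟩
    conj u a ∙ conj u (conj (u ⁻¹) d)     ≈⟨ ∙-congˡ (conj-conj-⁻¹ u d) ⟩
    conj u a ∙ d                          ∎

module FiniteGroup {c ℓ : Level} (G : Group c ℓ) (finite : IsFinite G) where
  open Group G
  open GroupTheory G
  open import Relation.Binary.Reasoning.Setoid setoid

  private
    _≟_ = proj₁ finite
    size = proj₁ (proj₂ finite)

  enum : Fin size → Carrier
  enum = proj₁ (proj₂ (proj₂ finite))

  enum-surjective : ∀ g → ∃ λ i → g ≈ enum i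
  enum-surjective = proj₂ (proj₂ (proj₂ finite))

  -- Abstract: only the existence of a period matters, and unfolding the pigeonhole
  -- argument inside orders makes later type checking blow up.
  abstract
    period : ∀ a → ∃ λ r → a ^ suc r ≈ ε
    period a with pigeonhole (n<1+n size) (λ k → proj₁ (enum-surjective (a ^ toℕ k)))
    ... | i , j , i<j , same with m≤n⇒∃[o]m+o≡n i<j
    ... | o , 1+i+o≡j = o , ∙-cancelˡ (a ^ toℕ i) _ _ (begin
      a ^ toℕ i ∙ a ^ suc o                   ≈⟨ ^-distribˡ-+-∙ a (toℕ i) (suc o) ⟨
      a ^ (toℕ i + suc o)                     ≡⟨ ≡.cong (a ^_) (≡.trans (+-suc (toℕ i) o) 1+i+o≡j) ⟩
      a ^ toℕ j                               ≈⟨ proj₂ (enum-surjective (a ^ toℕ j)) ⟩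
      enum (proj₁ (enum-surjective (a ^ toℕ j))) ≡⟨ ≡.cong enum same ⟨
      enum (proj₁ (enum-surjective (a ^ toℕ i))) ≈⟨ proj₂ (enum-surjective (a ^ toℕ i)) ⟨
      a ^ toℕ i                               ≈⟨ identityʳ _ ⟨
      a ^ toℕ i ∙ ε                           ∎)

  ⁻¹≈^ : ∀ a → ∃ λ r → a ⁻¹ ≈ a ^ r
  ⁻¹≈^ a with period a
  ... | r , a^[1+r]≈ε = r , sym (inverseʳ-unique a (a ^ r) a^[1+r]≈ε)

  ⁻¹-∈ : ∀ {p} {P : Pred Carrier p} → IsSubmonoid P → ∀ {a} → P a → P (a ⁻¹)
  ⁻¹-∈ P-sub {a} a∈P = ∈-resp-≈ (sym (proj₂ (⁻¹≈^ a))) (^-∈ (proj₁ (⁻¹≈^ a)) a∈P)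
    where open IsSubmonoid P-sub

  coset-isEquivalence : ∀ {p} {P : Pred Carrier p} → IsSubmonoid P →
                        IsEquivalence (λ g h → P (g ⁻¹ ∙ h))
  coset-isEquivalence P-sub = record
    { refl  = λ {g} → ∈-resp-≈ (sym (inverseˡ g)) ε-∈
    ; sym   = λ {g} {h} g⁻¹h∈P →
                ∈-resp-≈ (trans (⁻¹-anti-homo-∙ _ _) (∙-congˡ (⁻¹-involutive g))) (⁻¹-∈ P-sub g⁻¹h∈P)
    ; trans = λ {g} {h} {k} g⁻¹h∈P h⁻¹k∈P →
                ∈-resp-≈ (trans (assoc _ _ _) (∙-congˡ (\\-leftDividesˡ h k))) (∙-∈ g⁻¹h∈P h⁻¹k∈P)
    }
    where open IsSubmonoid P-sub

  powers? : ∀ a → Decidable (Powers a)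
  powers? a b with period a
  ... | r , a^[1+r]≈ε with any? (λ (i : Fin (suc r)) → b ≟ (a ^ toℕ i))
  ...   | yes (i , b≈a^i) = yes (toℕ i , b≈a^i)
  ...   | no ∄i = no λ { (k , b≈a^k) → ∄i (fromℕ< (m%n<n k (suc r)) , (begin
    b                                  ≈⟨ b≈a^k ⟩
    a ^ k                              ≈⟨ ^-mod-period r a^[1+r]≈ε k ⟩
    a ^ (k % suc r)                    ≡⟨ ≡.cong (a ^_) (toℕ-fromℕ< (m%n<n k (suc r))) ⟨
    a ^ toℕ (fromℕ< (m%n<n k (suc r))) ∎)) }

  inCyc⇒powers : ∀ {a b} → InCyc G a b → Powers a b
  inCyc⇒powers (+ k , b≈a^k) = k , b≈a^k
  inCyc⇒powers {a} (-[1+ k ] , b≈a^-[1+k]) =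
    ∈-resp-≈ (sym b≈a^-[1+k]) (⁻¹-∈ (powers-isSubmonoid a) (suc k , refl))
    where open IsSubmonoid (powers-isSubmonoid a)

  powers⇒inCyc : ∀ {a b} → Powers a b → InCyc G a b
  powers⇒inCyc (k , b≈a^k) = + k , b≈a^k

  inCyc-isSubmonoid : ∀ a → IsSubmonoid (InCyc G a)
  inCyc-isSubmonoid a = record
    { ∈-resp-≈ = λ { b≈b′ (z , b≈a^z) → z , trans (sym b≈b′) b≈a^z }
    ; ε-∈      = + 0 , refl
    ; ∙-∈      = λ b∈ b′∈ → powers⇒inCyc (∙-∈ (inCyc⇒powers b∈) (inCyc⇒powers b′∈))
    }
    where open IsSubmonoid (powers-isSubmonoid a)

  inCyc-abelian : ∀ a → IsAbelian (InCyc G a)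
  inCyc-abelian a b∈ b′∈ = powers-abelian a (inCyc⇒powers b∈) (inCyc⇒powers b′∈)

  inCyc? : ∀ a → Decidable (InCyc G a)
  inCyc? a b = map′ powers⇒inCyc inCyc⇒powers (powers? a b)

  module OrderModulo {p} {P : Pred Carrier p} (P-sub : IsSubmonoid P) (g : Carrier)
                     (P? : ∀ n → Dec (P (g ^ n))) where
    open IsSubmonoid P-sub

    private
      least = least-positive P? (proj₁ (period g)) (∈-resp-≈ (sym (proj₂ (period g))) ε-∈)

    order : ℕ
    order = suc (proj₁ least)

    ^order-∈ : P (g ^ order)
    ^order-∈ = proj₁ (proj₂ least)

    order-minimal : ∀ {d} → d < order → P (g ^ d) → d ≡ 0
    order-minimal {zero}  _         _      = ≡.refl
    order-minimal {suc j} (s≤s j<m) g^d∈P = contradiction g^d∈P (proj₂ (proj₂ least) j<m)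

    order-∣ : ∀ {k} → P (g ^ k) → order ∣ k
    order-∣ {k} g^k∈P = m%n≡0⇒n∣m k order (order-minimal (m%n<n k order) (∈-resp-≈ remainder
      (∙-∈ g^k∈P (⁻¹-∈ P-sub (^-∈ (k / order) ^order-∈)))))
      where
      remainder : g ^ k ∙ (g ^ order) ^ (k / order) ⁻¹ ≈ g ^ (k % order)
      remainder = trans (∙-congʳ (^-divMod g order k)) (//-rightDividesʳ _ _)

    ∣order⇒powers : ∀ {k} → order ∣ k → Powers (g ^ order) (g ^ k)
    ∣order⇒powers {k} (divides q k≡q*order) = q , (begin
      g ^ k            ≡⟨ ≡.cong (g ^_) k≡q*order ⟩
      g ^ (q * order)  ≈⟨ ^-*-assoc g order q ⟨
      (g ^ order) ^ q  ∎)

module BlackVertices {c ℓ : Level} (G : Group c ℓ) (finite : IsFinite G) (x : Group.Carrier G) where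
  open Group G
  open GroupTheory G
  open FiniteGroup G finite

  ⟨x⟩ : Pred Carrier ℓ
  ⟨x⟩ = InCyc G x

  K : Pred Carrier (c ⊔ ℓ)
  K = InKernel G x

  ⟨x⟩-isSubmonoid : IsSubmonoid ⟨x⟩
  ⟨x⟩-isSubmonoid = inCyc-isSubmonoid x

  module Cyc = IsSubmonoid ⟨x⟩-isSubmonoid

  x∈⟨x⟩ : x ∈ ⟨x⟩
  x∈⟨x⟩ = + 1 , sym (identityʳ x)

  module SameVertex = IsEquivalence (coset-isEquivalence ⟨x⟩-isSubmonoid)

  sameVertex-resp : ∀ {a a′ b b′} → a ≈ a′ → b ≈ b′ → SameVertex G x a b → SameVertex G x a′ b′
  sameVertex-resp a≈a′ b≈b′ = Cyc.∈-resp-≈ (∙-cong (⁻¹-cong a≈a′) b≈b′)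

  sameVertex-∙ʳ : ∀ a {h} → h ∈ ⟨x⟩ → SameVertex G x a (a ∙ h)
  sameVertex-∙ʳ a {h} h∈⟨x⟩ = Cyc.∈-resp-≈ (sym (\\-leftDividesʳ a h)) h∈⟨x⟩

  transitive : TransitiveOnVertices G x
  transitive v w = w ∙ v ⁻¹ , sameVertex-resp (sym (//-rightDividesˡ v w)) refl SameVertex.refl

  private
    fixes-as-conj : ∀ a v → (a ∙ v) ⁻¹ ∙ v ≈ conj v a ⁻¹
    fixes-as-conj a v = trans (∙-congʳ (⁻¹-anti-homo-∙ a v)) (conj-homo-⁻¹ v a)

  fixes⇒conj∈ : ∀ {a v} → Fixes G x a v → conj v a ∈ ⟨x⟩
  fixes⇒conj∈ {a} {v} fixes =
    Cyc.∈-resp-≈ (⁻¹-involutive _) (⁻¹-∈ ⟨x⟩-isSubmonoid (Cyc.∈-resp-≈ (fixes-as-conj a v) fixes))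

  conj∈⇒fixes : ∀ {a v} → conj v a ∈ ⟨x⟩ → Fixes G x a v
  conj∈⇒fixes {a} {v} conj∈ = Cyc.∈-resp-≈ (sym (fixes-as-conj a v)) (⁻¹-∈ ⟨x⟩-isSubmonoid conj∈)

  kernel⇒conj∈ : ∀ {a} → a ∈ K → ∀ v → conj v a ∈ ⟨x⟩
  kernel⇒conj∈ a∈K v = fixes⇒conj∈ (a∈K v)

  conj∈⇒kernel : ∀ {a} → (∀ v → conj v a ∈ ⟨x⟩) → a ∈ K
  conj∈⇒kernel conj∈ v = conj∈⇒fixes (conj∈ v)

  K-isSubmonoid : IsSubmonoid K
  K-isSubmonoid = record
    { ∈-resp-≈ = λ a≈b a∈K → conj∈⇒kernel λ v → Cyc.∈-resp-≈ (conj-cong refl a≈b) (kernel⇒conj∈ a∈K v)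
    ; ε-∈      = conj∈⇒kernel λ v → Cyc.∈-resp-≈ (sym (conj-homo-ε v)) Cyc.ε-∈
    ; ∙-∈      = λ a∈K b∈K → conj∈⇒kernel λ v →
                   Cyc.∈-resp-≈ (sym (conj-homo-∙ v _ _)) (Cyc.∙-∈ (kernel⇒conj∈ a∈K v) (kernel⇒conj∈ b∈K v))
    }

  module Ker = IsSubmonoid K-isSubmonoid

  K-conj : ∀ u {a} → a ∈ K → conj u a ∈ K
  K-conj u {a} a∈K = conj∈⇒kernel λ v → Cyc.∈-resp-≈ (conj-∙ u v a) (kernel⇒conj∈ a∈K (u ∙ v))

  K⊆⟨x⟩ : K ⊆ ⟨x⟩
  K⊆⟨x⟩ {a} a∈K = Cyc.∈-resp-≈ (conj-ε a) (kernel⇒conj∈ a∈K ε)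

  central⇒K : ∀ {a} → a ∈ ⟨x⟩ → (∀ u → a ∙ u ≈ u ∙ a) → a ∈ K
  central⇒K a∈⟨x⟩ central = conj∈⇒kernel λ v → Cyc.∈-resp-≈ (sym (comm⇒conj≈ (central v))) a∈⟨x⟩

  K? : Decidable K
  K? a = map′
    (λ conj∈ → conj∈⇒kernel λ v →
      Cyc.∈-resp-≈ (conj-cong (sym (proj₂ (enum-surjective v))) refl) (conj∈ (proj₁ (enum-surjective v))))
    (λ a∈K i → kernel⇒conj∈ a∈K (enum i))
    (all? λ i → inCyc? x (conj (enum i) a))

  K-isNormalSubgroup : IsNormalSubgroup G K
  K-isNormalSubgroup = Ker.∈-resp-≈ , Ker.ε-∈ , Ker.∙-∈ , ⁻¹-∈ K-isSubmonoid ,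
    λ g a∈K → Ker.∈-resp-≈ (∙-congʳ (∙-congʳ (⁻¹-involutive g))) (K-conj (g ⁻¹) a∈K)

  K-cyclic : IsCyclic G K
  K-cyclic = x ^ order , ^order-∈ , λ a a∈K →
    let k , a≈x^k = inCyc⇒powers (K⊆⟨x⟩ a∈K)
    in powers⇒inCyc (Pow.∈-resp-≈ (sym a≈x^k) (∣order⇒powers (order-∣ {k} (Ker.∈-resp-≈ a≈x^k a∈K))))
    where
    open OrderModulo K-isSubmonoid x (λ n → K? (x ^ n))
    module Pow = IsSubmonoid (powers-isSubmonoid (x ^ order))

  ⟨x⟩⊆K : x ∈ K → ⟨x⟩ ⊆ K
  ⟨x⟩⊆K x∈K a∈⟨x⟩ = let k , a≈x^k = inCyc⇒powers a∈⟨x⟩ in Ker.∈-resp-≈ (sym a≈x^k) (Ker.^-∈ k x∈K)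

  regular : x ∈ K → RegularOnVertices G x
  regular x∈K = transitive , λ a v fixes →
    Ker.∈-resp-≈ (conj-⁻¹-conj v a) (K-conj (v ⁻¹) (⟨x⟩⊆K x∈K (fixes⇒conj∈ fixes)))

module PrimitiveDessin {c ℓ : Level} (G : Group c ℓ) (finite : IsFinite G) (x : Group.Carrier G)
                       (prim : IsPrimitiveOnVertices G x) where
  open Group G
  open GroupTheory G
  open FiniteGroup G finite
  open BlackVertices G finite x

  -- The cosets of a subgroup L ⊇ ⟨x⟩ are blocks of imprimitivity.
  subgroup-dichotomy : ∀ {L : Pred Carrier (c ⊔ ℓ)} → IsSubmonoid L → ⟨x⟩ ⊆ L →
                       L ⊆ ⟨x⟩ ⊎ (∀ a → a ∈ L)
  subgroup-dichotomy {L} L-sub ⟨x⟩⊆L = Sum.map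
    (λ coset⊆ {a} a∈L → Cyc.∈-resp-≈ (ε⁻¹∙ a) (coset⊆ ε a (∈-resp-≈ (sym (ε⁻¹∙ a)) a∈L)))
    (λ all a → ∈-resp-≈ (ε⁻¹∙ a) (all ε a))
    (proj₂ prim (λ g h → L (g ⁻¹ ∙ h)) (coset-isEquivalence L-sub)
                (λ _ _ → ⟨x⟩⊆L) (λ a g h → ∈-resp-≈ (sym (⁻¹∙-translate a g h))))
    where open IsSubmonoid L-sub

  g₀ : Carrier
  g₀ = proj₁ (proj₁ prim)

  g₀∉⟨x⟩ : g₀ ∉ ⟨x⟩
  g₀∉⟨x⟩ g₀∈⟨x⟩ = proj₂ (proj₁ prim) (Cyc.∈-resp-≈ (sym (ε⁻¹∙ g₀)) g₀∈⟨x⟩)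

  Normalises : Pred Carrier (c ⊔ ℓ)
  Normalises u = ∀ {a} → a ∈ ⟨x⟩ → conj u a ∈ ⟨x⟩

  normalises-isSubmonoid : IsSubmonoid Normalises
  normalises-isSubmonoid = record
    { ∈-resp-≈ = λ u≈u′ u∈N a∈⟨x⟩ → Cyc.∈-resp-≈ (conj-cong u≈u′ refl) (u∈N a∈⟨x⟩)
    ; ε-∈      = λ {a} a∈⟨x⟩ → Cyc.∈-resp-≈ (sym (conj-ε a)) a∈⟨x⟩
    ; ∙-∈      = λ {u} {w} u∈N w∈N {a} a∈⟨x⟩ → Cyc.∈-resp-≈ (sym (conj-∙ u w a)) (w∈N (u∈N a∈⟨x⟩))
    }

  ⟨x⟩⊆normalises : ⟨x⟩ ⊆ Normalises
  ⟨x⟩⊆normalises u∈⟨x⟩ a∈⟨x⟩ = Cyc.∙-∈ (Cyc.∙-∈ (⁻¹-∈ ⟨x⟩-isSubmonoid u∈⟨x⟩) a∈⟨x⟩) u∈⟨x⟩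

  normalises-generator : ∀ {u} → conj u x ∈ ⟨x⟩ → u ∈ Normalises
  normalises-generator {u} ux∈⟨x⟩ a∈⟨x⟩ =
    let k , a≈x^k = inCyc⇒powers a∈⟨x⟩
    in Cyc.∈-resp-≈ (sym (trans (conj-cong refl a≈x^k) (conj-homo-^ u x k))) (Cyc.^-∈ k ux∈⟨x⟩)

  self-normalising : x ∉ K → ∀ {g} → conj g x ∈ ⟨x⟩ → g ∈ ⟨x⟩
  self-normalising x∉K gx∈⟨x⟩ = Sum.[
    (λ N⊆⟨x⟩ → N⊆⟨x⟩ (normalises-generator gx∈⟨x⟩)) ,
    (λ all → contradiction (conj∈⇒kernel λ v → all v x∈⟨x⟩) x∉K) ]′
    (subgroup-dichotomy {L = Normalises} normalises-isSubmonoid ⟨x⟩⊆normalises)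

  -- D = ⟨x⟩ ∩ g⟨x⟩g⁻¹; its centraliser contains ⟨x⟩ and g x g⁻¹ = conj (g ⁻¹) x.
  two-fixed-points⇒K : x ∉ K → ∀ a v w → ¬ SameVertex G x v w → Fixes G x a v → Fixes G x a w → a ∈ K
  two-fixed-points⇒K x∉K a v w v≉w fixes-v fixes-w = Sum.[ centraliser⊆⟨x⟩-absurd , centraliser-all⇒a∈K ]′
    (subgroup-dichotomy (centraliser-isSubmonoid {D = D}) (abelian⊆centraliser (inCyc-abelian x) proj₁))
    where
    g = v ⁻¹ ∙ w
    D : Pred Carrier ℓ
    D = ⟨x⟩ ∩ (λ d → conj g d ∈ ⟨x⟩)

    b = conj v a
    b∈D : b ∈ D
    b∈D = fixes⇒conj∈ fixes-v ,
          Cyc.∈-resp-≈ (trans (conj-cong (sym (\\-leftDividesˡ v w)) refl) (conj-∙ v g a)) (fixes⇒conj∈ fixes-w)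

    centraliser-all⇒a∈K : (∀ u → u ∈ Centraliser D) → a ∈ K
    centraliser-all⇒a∈K all = Ker.∈-resp-≈ (conj-⁻¹-conj v a)
      (K-conj (v ⁻¹) (central⇒K (proj₁ b∈D) λ u → all u b b∈D))

    centraliser⊆⟨x⟩-absurd : Centraliser D ⊆ ⟨x⟩ → a ∈ K
    centraliser⊆⟨x⟩-absurd C⊆⟨x⟩ = contradiction (Cyc.∈-resp-≈ (⁻¹-involutive g) (⁻¹-∈ ⟨x⟩-isSubmonoid g⁻¹∈⟨x⟩)) v≉w
      where
      g⁻¹∈⟨x⟩ : g ⁻¹ ∈ ⟨x⟩
      g⁻¹∈⟨x⟩ = self-normalising x∉K (C⊆⟨x⟩ (abelian⊆centraliser
        (λ ga∈ gb∈ → conj-reflects-comm g (inCyc-abelian x ga∈ gb∈)) proj₂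
        (Cyc.∈-resp-≈ (sym (conj-conj-⁻¹ g x)) x∈⟨x⟩)))

  frobenius : x ∉ K → FrobeniusOnVertices G x
  frobenius x∉K = transitive ,
    (x , ε , conj∈⇒fixes (Cyc.∈-resp-≈ (sym (conj-ε x)) x∈⟨x⟩) , x∉K) ,
    two-fixed-points⇒K x∉K

  K-central : x ∉ K → InCentre G K
  K-central x∉K = Sum.[
    (λ C⊆⟨x⟩ → contradiction (conj∈⇒kernel λ g → C⊆⟨x⟩ (centraliser-conj K-conj g (⟨x⟩⊆C x∈⟨x⟩))) x∉K) ,
    (λ all a a∈K g → all g a a∈K) ]′
    (subgroup-dichotomy (centraliser-isSubmonoid {D = K}) ⟨x⟩⊆C)
    where
    ⟨x⟩⊆C : ⟨x⟩ ⊆ Centraliser K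
    ⟨x⟩⊆C = abelian⊆centraliser (inCyc-abelian x) K⊆⟨x⟩

  module NormalCase (x∈K : x ∈ K) where
    ⟨x⟩-normal : ∀ u {a} → a ∈ ⟨x⟩ → conj u a ∈ ⟨x⟩
    ⟨x⟩-normal u a∈⟨x⟩ = K⊆⟨x⟩ (K-conj u (⟨x⟩⊆K x∈K a∈⟨x⟩))

    sameVertex-∙ : ∀ {a b d d′} → SameVertex G x a b → SameVertex G x d d′ →
                   SameVertex G x (a ∙ d) (b ∙ d′)
    sameVertex-∙ {a} {b} {d} {d′} a~b d~d′ =
      Cyc.∈-resp-≈ (sym (⁻¹∙-∙ a b d d′)) (Cyc.∙-∈ (⟨x⟩-normal d a~b) d~d′)

    -- The subgroup ⟨u⟩⟨x⟩, lifted to the universe level at which primitivity quantifies.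
    ⟨_⟩⟨x⟩ : Carrier → Pred Carrier (c ⊔ ℓ)
    ⟨ u ⟩⟨x⟩ g = Lift c (∃ λ k → SameVertex G x (u ^ k) g)

    ⟨_⟩⟨x⟩-isSubmonoid : ∀ u → IsSubmonoid ⟨ u ⟩⟨x⟩
    ⟨ u ⟩⟨x⟩-isSubmonoid = record
      { ∈-resp-≈ = λ { g≈g′ (lift (k , u^k~g)) → lift (k , sameVertex-resp refl g≈g′ u^k~g) }
      ; ε-∈      = lift (0 , SameVertex.refl)
      ; ∙-∈      = λ { (lift (k , u^k~g)) (lift (k′ , u^k′~g′)) →
          lift (k + k′ , sameVertex-resp (sym (^-distribˡ-+-∙ u k k′)) refl (sameVertex-∙ u^k~g u^k′~g′)) }
      }

    coset-power : ∀ {u} → u ∉ ⟨x⟩ → ∀ g → ∃ λ k → SameVertex G x (u ^ k) g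
    coset-power {u} u∉⟨x⟩ g = Sum.[
      (λ ⊆⟨x⟩ → contradiction (Cyc.∈-resp-≈ (identityʳ u) (⊆⟨x⟩ (lift (1 , SameVertex.refl)))) u∉⟨x⟩) ,
      (λ all → lower (all g)) ]′
      (subgroup-dichotomy ⟨ u ⟩⟨x⟩-isSubmonoid λ {a} a∈⟨x⟩ → lift (0 , Cyc.∈-resp-≈ (sym (ε⁻¹∙ a)) a∈⟨x⟩))

    open OrderModulo ⟨x⟩-isSubmonoid g₀ (λ n → inCyc? x (g₀ ^ n))

    vertex : Fin order → Carrier
    vertex i = g₀ ^ toℕ i

    vertex-injective-≤ : ∀ {i j} → i ≤ j → j < order → SameVertex G x (g₀ ^ i) (g₀ ^ j) → i ≡ j
    vertex-injective-≤ {i} {j} i≤j j<order i~j with m≤n⇒∃[o]m+o≡n i≤j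
    ... | o , i+o≡j = ≡.trans (≡.sym (+-identityʳ i)) (≡.subst (λ t → i + t ≡ j) o≡0 i+o≡j)
      where
      o≡0 : o ≡ 0
      o≡0 = order-minimal (≤-<-trans (≡.subst (o ≤_) i+o≡j (m≤n+m o i)) j<order)
        (Cyc.∈-resp-≈ (trans (∙-congˡ (^-distribˡ-+-∙ g₀ i o)) (\\-leftDividesʳ _ _))
          (sameVertex-resp refl (reflexive (≡.cong (g₀ ^_) (≡.sym i+o≡j))) i~j))

    vertex-injective : ∀ i j → SameVertex G x (vertex i) (vertex j) → i ≡ j
    vertex-injective i j i~j with ≤-total (toℕ i) (toℕ j)
    ... | inj₁ i≤j = toℕ-injective (vertex-injective-≤ i≤j (toℕ<n j) i~j)
    ... | inj₂ j≤i = toℕ-injective (≡.sym (vertex-injective-≤ j≤i (toℕ<n i) (SameVertex.sym i~j)))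

    vertex-surjective : ∀ g → ∃ λ i → SameVertex G x g (vertex i)
    vertex-surjective g with coset-power g₀∉⟨x⟩ g
    ... | k , g₀^k~g = i , SameVertex.trans (SameVertex.sym g₀^k~g) (SameVertex.sym reduce)
      where
      i = fromℕ< (m%n<n k order)
      reduce : SameVertex G x (vertex i) (g₀ ^ k)
      reduce = sameVertex-resp (reflexive (≡.cong (g₀ ^_) (≡.sym (toℕ-fromℕ< (m%n<n k order)))))
                               (sym (^-divMod g₀ order k))
                               (sameVertex-∙ʳ _ (Cyc.^-∈ (k / order) ^order-∈))

    1<order : 1 < order
    1<order = ≤∧≢⇒< (s≤s z≤n) λ 1≡order →
      g₀∉⟨x⟩ (Cyc.∈-resp-≈ (identityʳ g₀) (≡.subst (λ n → g₀ ^ n ∈ ⟨x⟩) (≡.sym 1≡order) ^order-∈))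

    order∣pred : ∀ {n} → SameVertex G x (g₀ ^ n) g₀ → ∃ λ s → n ≡ suc s × order ∣ s
    order∣pred {zero}  ε~g₀    = contradiction ε~g₀ (proj₂ (proj₁ prim))
    order∣pred {suc s} g₀^n~g₀ =
      s , ≡.refl , order-∣ (Cyc.∈-resp-≈ (\\-leftDividesʳ g₀ (g₀ ^ s)) (SameVertex.sym g₀^n~g₀))

    no-proper-divisor : ∀ {d} → 1 < d → d < order → ¬ d ∣ order
    no-proper-divisor {d} 1<d d<order d∣order with coset-power g₀^d∉⟨x⟩ g₀
      where
      g₀^d∉⟨x⟩ : g₀ ^ d ∉ ⟨x⟩
      g₀^d∉⟨x⟩ g₀^d∈⟨x⟩ = contradiction (≡.subst (1 <_) (order-minimal d<order g₀^d∈⟨x⟩) 1<d) λ ()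
    ... | j , g₀^d^j~g₀ with order∣pred (sameVertex-resp (^-*-assoc g₀ d j) refl g₀^d^j~g₀)
    ...   | s , j*d≡1+s , order∣s = <-irrefl (≡.sym (∣1⇒≡1 d∣1)) 1<d
      where
      d∣1 : d ∣ 1
      d∣1 = ∣m+n∣m⇒∣n (≡.subst (d ∣_) (≡.trans j*d≡1+s (+-comm 1 s)) (divides j ≡.refl)) (∣-trans d∣order order∣s)

    order-prime : Prime order
    order-prime = prime ⦃ n>1⇒nonTrivial 1<order ⦄
      λ { (composite {d} d<order d∣order) → no-proper-divisor (nonTrivial⇒n>1 d) d<order d∣order }

    prime-many-vertices : ∃ λ p → Prime p × NumVertices G x p
    prime-many-vertices = order , order-prime , vertex , vertex-injective , vertex-surjective

proposition10p1 : ∀ {c ℓ : Level} (G : Group c ℓ) (x y : Group.Carrier G) →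
    IsFinite G → Generates G x y → IsPrimitiveOnVertices G x →
    (IsNormalSubgroup G (InKernel G x) × IsCyclic G (InKernel G x)) ×
    ((RegularOnVertices G x × (∃ λ (p : ℕ) → Prime p × NumVertices G x p))
     ⊎ (FrobeniusOnVertices G x × InCentre G (InKernel G x)))
proposition10p1 G x _ finite _ prim =
  (K-isNormalSubgroup , K-cyclic) ,
  Sum.map (λ x∈K → regular x∈K , NormalCase.prime-many-vertices x∈K)
          (λ x∉K → frobenius x∉K , K-central x∉K)
          (toSum (K? x))
  where
  open BlackVertices G finite x
  open PrimitiveDessin G finite x prim
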